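{- Let $G$ be a graph and let $\chi: V(G)\to\{\text{red},\text{green}\}$ be a colouring in which every vertex independently receives each of the two colours with probability $1/2$. Let $S\subseteq V(G)$ be a connected locally minimal defensive alliance of size $k$ in $G$. Then the probability that all elements of $S$ are coloured green and all elements of $N(S)$ are coloured red is at least $\frac{1}{2^{k^2+k}}$.
   Context: All graphs are finite, simple and undirected; $N(v)$ and $N[v]$ denote open and closed neighbourhoods, and $N(S)=\big(\bigcup_{v\in S}N(v)\big)\setminus S$. A non-empty set $S\subseteq V$ is a defensive alliance if for each $v\in S$, $|N[v]\cap S|\ge|N(v)\setminus S|$. It is connected if $G[S]$ is connected. A connected defensive alliance $S$ is a connected locally minimal defensive alliance if for every $v\in S$, $S\setminus\{v\}$ is not a connected defensive alliance. -}

module Defs where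

open import Data.Nat using (ℕ; zero; suc; _≤_; _+_; _*_; _^_)
open import Data.Bool using (Bool; true; false; not; _∧_; T)
open import Data.Fin using (Fin)
open import Data.Fin.Subset using (Subset; _∈_; _∉_; _∩_; _∪_; _─_; ⁅_⁆; ∣_∣; Nonempty; _-_)
open import Data.Vec using (Vec; []; _∷_; tabulate; lookup; countᵇ)
open import Data.List using (List; []; _∷_; _++_; map; allFin; length; filterᵇ)
open import Data.Bool.ListAction using (any; all)
open import Data.Product using (_×_; Σ)
open import Relation.Nullary using (¬_)
open import Relation.Binary.PropositionalEquality using (_≡_)

record Graph (n : ℕ) : Set where
  field
    adj    : Fin n → Fin n → Bool
    sym    : ∀ u v → adj u v ≡ adj v u
    irrefl : ∀ v → adj v v ≡ false

open Graph public

module _ {n : ℕ} (G : Graph n) where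

  N : Fin n → Subset n
  N v = tabulate (adj G v)

  N[_] : Fin n → Subset n
  N[ v ] = N v ∪ ⁅ v ⁆

  NSet : Subset n → Subset n
  NSet S = tabulate (λ u → any (λ v → lookup S v ∧ adj G v u) (allFin n)) ─ S

  DefensiveAlliance : Subset n → Set
  DefensiveAlliance S =
    Nonempty S × (∀ v → v ∈ S → ∣ N v ─ S ∣ ≤ ∣ N[ v ] ∩ S ∣)

  data WalkIn (S : Subset n) : Fin n → Fin n → Set where
    here : ∀ {u} → u ∈ S → WalkIn S u u
    step : ∀ {u v w} → u ∈ S → T (adj G u v) → WalkIn S v w → WalkIn S u w

  Connected : Subset n → Set
  Connected S = ∀ u w → u ∈ S → w ∈ S → WalkIn S u w

  ConnectedDefensiveAlliance : Subset n → Set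
  ConnectedDefensiveAlliance S = DefensiveAlliance S × Connected S

  ConnectedLocallyMinimalDA : Subset n → Set
  ConnectedLocallyMinimalDA S =
    ConnectedDefensiveAlliance S ×
    (∀ v → v ∈ S → ¬ ConnectedDefensiveAlliance (S - v))

-- all 2^n colourings of Fin n; a colouring χ is encoded as the set of
-- green vertices (true = green, false = red)
colourings : (n : ℕ) → List (Subset n)
colourings zero    = [] ∷ []
colourings (suc n) = map (true ∷_) (colourings n) ++ map (false ∷_) (colourings n)

module _ {n : ℕ} (G : Graph n) where

  goodColouring : Subset n → Subset n → Bool
  goodColouring S χ =
    all (λ u → (not (lookup S u) Data.Bool.∨ lookup χ u)
               ∧ (not (lookup (NSet G S) u) Data.Bool.∨ not (lookup χ u)))
        (allFin n)

  -- number of colourings (out of 2^n equally likely ones) that are good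
  #good : Subset n → ℕ
  #good S = length (filterᵇ (goodColouring S) (colourings n))

{-# OPTIONS --safe #-}
-- Disjoint sets S and R are coloured green and red respectively by exactly
-- 2^(n - |S| - |R|) of the 2^n colourings, so the probability is 2^-(|S| + |N(S)|).
-- In a defensive alliance every v ∈ S has |N(v) ∖ S| ≤ |N[v] ∩ S| ≤ |S| = k,
-- hence |N(S)| ≤ k², and the probability is at least 2^-(k² + k).
module Submission where

open import Defs hiding (sym)
open import Data.Bool using (Bool; true; false; not; _∧_; _∨_; T)
open import Data.Bool.ListAction using (and; any)
open import Data.Bool.Properties using (T-≡; T-∧)
open import Data.Fin using (Fin; zero; suc)
open import Data.Fin.Subset
  using (Subset; inside; outside; _∈_; _∉_; _⊆_; _∩_; _∪_; _─_; ⊥; ∣_∣; Empty)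
open import Data.Fin.Subset.Properties
  using (x∈p∩q⁻; x∈p∪q⁺; p─q⊆p; x∈p∧x∉q⇒x∈p─q; p⊆q⇒∣p∣≤∣q∣; ∣p∩q∣≤∣q∣; ∣⊥∣≡0)
open import Data.List using (List; []; _∷_; _++_; map; length; filterᵇ; tabulate; allFin)
open import Data.List.Properties using (filter-++; length-++; map-tabulate)
open import Data.List.Relation.Unary.Any using (satisfied)
open import Data.List.Relation.Unary.Any.Properties using (any⁻)
open import Data.Nat using (ℕ; suc; _+_; _*_; _^_; _≤_; s≤s)
open import Data.Nat.Properties
  using (≤-refl; ≤-reflexive; ≤-trans; n≤1+n; +-suc; +-comm; +-identityʳ; +-mono-≤; +-monoʳ-≤;
         *-assoc; *-comm; *-distribʳ-+; *-monoʳ-≤; ^-monoʳ-≤; module ≤-Reasoning)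
open import Data.Empty using (⊥-elim)
open import Data.Product using (_×_; _,_; ∃-syntax)
open import Data.Sum using (inj₁; inj₂)
open import Data.Vec as Vec using ([]; _∷_; lookup; here; there)
open import Data.Vec.Properties using (lookup⇒[]=; []=⇒lookup; lookup∘tabulate)
open import Function using (_∘_; id; Equivalence)
open import Relation.Nullary.Decidable using (T?)
open import Relation.Binary.PropositionalEquality
  using (_≡_; refl; sym; trans; cong; cong₂; module ≡-Reasoning)

private
  variable
    A B : Set
    m n : ℕ

count : (A → Bool) → List A → ℕ
count p xs = length (filterᵇ p xs)

count-++ : ∀ (p : A → Bool) xs ys → count p (xs ++ ys) ≡ count p xs + count p ys
count-++ p xs ys = trans (cong length (filter-++ (T? ∘ p) xs ys)) (length-++ (filterᵇ p xs))

count-map : ∀ (p : B → Bool) (f : A → B) xs → count p (map f xs) ≡ count (p ∘ f) xs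
count-map p f []       = refl
count-map p f (x ∷ xs) with p (f x)
... | true  = cong suc (count-map p f xs)
... | false = count-map p f xs

count-cong : ∀ {p q : A → Bool} → (∀ x → p x ≡ q x) → ∀ xs → count p xs ≡ count q xs
count-cong p≗q []       = refl
count-cong {p = p} {q} p≗q (x ∷ xs) with p x | q x | p≗q x
... | true  | true  | refl = cong suc (count-cong p≗q xs)
... | false | false | refl = count-cong p≗q xs

count-false : ∀ (xs : List A) → count (λ _ → false) xs ≡ 0
count-false []       = refl
count-false (x ∷ xs) = count-false xs

count-colourings-suc : ∀ (p : Subset (suc n) → Bool) →
  count p (colourings (suc n)) ≡
  count (p ∘ (true ∷_)) (colourings n) + count (p ∘ (false ∷_)) (colourings n)
count-colourings-suc {n} p = begin
  count p (map (true ∷_) cs ++ map (false ∷_) cs)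
    ≡⟨ count-++ p (map (true ∷_) cs) _ ⟩
  count p (map (true ∷_) cs) + count p (map (false ∷_) cs)
    ≡⟨ cong₂ _+_ (count-map p (true ∷_) cs) (count-map p (false ∷_) cs) ⟩
  count (p ∘ (true ∷_)) cs + count (p ∘ (false ∷_)) cs ∎
  where
  open ≡-Reasoning
  cs = colourings n

greenRed : Bool → Bool → Bool → Bool
greenRed s r c = (not s ∨ c) ∧ (not r ∨ not c)

paints : Subset n → Subset n → Subset n → Bool
paints S R χ = and (tabulate (λ u → greenRed (lookup S u) (lookup R u) (lookup χ u)))

goodColouring≡paints : ∀ (G : Graph n) S χ → goodColouring G S χ ≡ paints S (NSet G S) χ
goodColouring≡paints {n} G S χ =
  cong and (map-tabulate {n = n} id λ u → greenRed (lookup S u) (lookup (NSet G S) u) (lookup χ u))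

Empty-∩-tail : ∀ s r {S R : Subset n} → Empty ((s ∷ S) ∩ (r ∷ R)) → Empty (S ∩ R)
Empty-∩-tail _ _ empty (x , x∈S∩R) = empty (suc x , there x∈S∩R)

private
  doubling : ∀ c e {d} → c * 2 ^ e ≡ d → c * 2 ^ suc e ≡ 2 * d
  doubling c e {d} c2ᵉ≡d = begin
    c * (2 * 2 ^ e) ≡⟨ sym (*-assoc c 2 (2 ^ e)) ⟩
    c * 2 * 2 ^ e   ≡⟨ cong (_* 2 ^ e) (*-comm c 2) ⟩
    2 * c * 2 ^ e   ≡⟨ *-assoc 2 c (2 ^ e) ⟩
    2 * (c * 2 ^ e) ≡⟨ cong (2 *_) c2ᵉ≡d ⟩
    2 * d           ∎
    where open ≡-Reasoning

count-paints : ∀ (S R : Subset n) → Empty (S ∩ R) →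
  count (paints S R) (colourings n) * 2 ^ (∣ S ∣ + ∣ R ∣) ≡ 2 ^ n
count-paints [] [] _ = refl
count-paints {suc n} (inside ∷ S) (inside ∷ R) empty = ⊥-elim (empty (zero , here))
count-paints {suc n} (inside ∷ S) (outside ∷ R) empty
  rewrite count-colourings-suc {n} (paints (inside ∷ S) (outside ∷ R))
        | count-false (colourings n) | +-identityʳ (count (paints S R) (colourings n)) =
  doubling (count (paints S R) (colourings n)) (∣ S ∣ + ∣ R ∣)
    (count-paints S R (Empty-∩-tail inside outside empty))
count-paints {suc n} (outside ∷ S) (inside ∷ R) empty
  rewrite count-colourings-suc {n} (paints (outside ∷ S) (inside ∷ R))
        | count-false (colourings n) | +-suc ∣ S ∣ ∣ R ∣ =
  doubling (count (paints S R) (colourings n)) (∣ S ∣ + ∣ R ∣)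
    (count-paints S R (Empty-∩-tail outside inside empty))
count-paints {suc n} (outside ∷ S) (outside ∷ R) empty = begin
  count (paints (outside ∷ S) (outside ∷ R)) (colourings (suc n)) * 2 ^ e
    ≡⟨ cong (_* 2 ^ e) (count-colourings-suc (paints (outside ∷ S) (outside ∷ R))) ⟩
  (c + c) * 2 ^ e        ≡⟨ *-distribʳ-+ (2 ^ e) c c ⟩
  c * 2 ^ e + c * 2 ^ e  ≡⟨ cong₂ _+_ ih ih ⟩
  2 ^ n + 2 ^ n          ≡⟨ cong (2 ^ n +_) (sym (+-identityʳ (2 ^ n))) ⟩
  2 * 2 ^ n              ∎
  where
  open ≡-Reasoning
  c = count (paints S R) (colourings n)
  e = ∣ S ∣ + ∣ R ∣
  ih : c * 2 ^ e ≡ 2 ^ n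
  ih = count-paints S R (Empty-∩-tail outside outside empty)

∣p∪q∣≤∣p∣+∣q∣ : ∀ (p q : Subset n) → ∣ p ∪ q ∣ ≤ ∣ p ∣ + ∣ q ∣
∣p∪q∣≤∣p∣+∣q∣ []            []            = ≤-refl
∣p∪q∣≤∣p∣+∣q∣ (outside ∷ p) (outside ∷ q) = ∣p∪q∣≤∣p∣+∣q∣ p q
∣p∪q∣≤∣p∣+∣q∣ (inside  ∷ p) (outside ∷ q) = s≤s (∣p∪q∣≤∣p∣+∣q∣ p q)
∣p∪q∣≤∣p∣+∣q∣ (outside ∷ p) (inside  ∷ q) =
  ≤-trans (s≤s (∣p∪q∣≤∣p∣+∣q∣ p q)) (≤-reflexive (sym (+-suc ∣ p ∣ ∣ q ∣)))
∣p∪q∣≤∣p∣+∣q∣ (inside  ∷ p) (inside  ∷ q) =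
  s≤s (≤-trans (∣p∪q∣≤∣p∣+∣q∣ p q) (+-monoʳ-≤ ∣ p ∣ (n≤1+n ∣ q ∣)))

x∈p─q⇒x∉q : ∀ {x : Fin n} (p q : Subset n) → x ∈ p ─ q → x ∉ q
x∈p─q⇒x∉q (_ ∷ p) (outside ∷ q) (there x∈p─q) (there x∈q) = x∈p─q⇒x∉q p q x∈p─q x∈q
x∈p─q⇒x∉q (_ ∷ p) (inside  ∷ q) (there x∈p─q) (there x∈q) = x∈p─q⇒x∉q p q x∈p─q x∈q

Empty-p∩q─p : ∀ (p q : Subset n) → Empty (p ∩ (q ─ p))
Empty-p∩q─p p q (x , x∈p∩q─p) with x∈p∩q⁻ p (q ─ p) x∈p∩q─p
... | x∈p , x∈q─p = x∈p─q⇒x∉q q p x∈q─p x∈p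

⋃∈ : Subset n → (Fin n → Subset m) → Subset m
⋃∈ []            T = ⊥
⋃∈ (inside  ∷ S) T = T zero ∪ ⋃∈ S (T ∘ suc)
⋃∈ (outside ∷ S) T = ⋃∈ S (T ∘ suc)

∈⋃∈ : ∀ {S : Subset n} {T : Fin n → Subset m} {v x} → v ∈ S → x ∈ T v → x ∈ ⋃∈ S T
∈⋃∈ {S = inside  ∷ S} here       x∈Tv = x∈p∪q⁺ (inj₁ x∈Tv)
∈⋃∈ {S = inside  ∷ S} (there v∈S) x∈Tv = x∈p∪q⁺ (inj₂ (∈⋃∈ v∈S x∈Tv))
∈⋃∈ {S = outside ∷ S} (there v∈S) x∈Tv = ∈⋃∈ v∈S x∈Tv

∣⋃∈∣≤ : ∀ (S : Subset n) (T : Fin n → Subset m) {b} →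
  (∀ {v} → v ∈ S → ∣ T v ∣ ≤ b) → ∣ ⋃∈ S T ∣ ≤ ∣ S ∣ * b
∣⋃∈∣≤ {m = m} []  T bound = ≤-reflexive (∣⊥∣≡0 m)
∣⋃∈∣≤ (inside  ∷ S) T bound = ≤-trans (∣p∪q∣≤∣p∣+∣q∣ (T zero) (⋃∈ S (T ∘ suc)))
  (+-mono-≤ (bound here) (∣⋃∈∣≤ S (T ∘ suc) (bound ∘ there)))
∣⋃∈∣≤ (outside ∷ S) T bound = ∣⋃∈∣≤ S (T ∘ suc) (bound ∘ there)

∈tabulate⁺ : ∀ (f : Fin n → Bool) {x} → T (f x) → x ∈ Vec.tabulate f
∈tabulate⁺ f {x} fx = lookup⇒[]= x _ (trans (lookup∘tabulate f x) (Equivalence.to T-≡ fx))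

∈tabulate⁻ : ∀ (f : Fin n → Bool) {x} → x ∈ Vec.tabulate f → T (f x)
∈tabulate⁻ f {x} x∈ = Equivalence.from T-≡ (trans (sym (lookup∘tabulate f x)) ([]=⇒lookup x∈))

module _ (G : Graph n) where

  ∈NSet⁻ : ∀ {S x} → x ∈ NSet G S → x ∉ S × ∃[ v ] (v ∈ S × x ∈ N G v)
  ∈NSet⁻ {S} {x} x∈NSet
    with v , Sv∧vx ← satisfied (any⁻ (λ v → lookup S v ∧ adj G v x) (allFin n)
                                     (∈tabulate⁻ _ (p─q⊆p _ S x∈NSet)))
    with Sv , vx ← Equivalence.to T-∧ Sv∧vx
    = x∈p─q⇒x∉q _ S x∈NSet , v , lookup⇒[]= v S (Equivalence.to T-≡ Sv) , ∈tabulate⁺ (adj G v) vx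

  NSet⊆⋃∈ : ∀ S → NSet G S ⊆ ⋃∈ S (λ v → N G v ─ S)
  NSet⊆⋃∈ S x∈NSet with ∈NSet⁻ x∈NSet
  ... | x∉S , v , v∈S , x∈Nv = ∈⋃∈ v∈S (x∈p∧x∉q⇒x∈p─q x∈Nv x∉S)

  ∣NSet∣≤∣S∣² : ∀ {S} → DefensiveAlliance G S → ∣ NSet G S ∣ ≤ ∣ S ∣ * ∣ S ∣
  ∣NSet∣≤∣S∣² {S} (_ , defended) = ≤-trans (p⊆q⇒∣p∣≤∣q∣ (NSet⊆⋃∈ S))
    (∣⋃∈∣≤ S (λ v → N G v ─ S) λ {v} v∈S → ≤-trans (defended v v∈S) (∣p∩q∣≤∣q∣ (N[_] G v) S))

lemma1 : ∀ {n : ℕ} (G : Graph n) (S : Subset n) (k : ℕ) →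
         ConnectedLocallyMinimalDA G S → ∣ S ∣ ≡ k →
         2 ^ n ≤ #good G S * 2 ^ (k * k + k)
lemma1 {n} G S _ ((alliance , _) , _) refl = begin
  2 ^ n
    ≡⟨ sym (count-paints S R (Empty-p∩q─p S _)) ⟩
  count (paints S R) (colourings n) * 2 ^ (∣ S ∣ + ∣ R ∣)
    ≡⟨ cong (_* 2 ^ (∣ S ∣ + ∣ R ∣))
            (count-cong (λ χ → sym (goodColouring≡paints G S χ)) (colourings n)) ⟩
  #good G S * 2 ^ (∣ S ∣ + ∣ R ∣)
    ≤⟨ *-monoʳ-≤ (#good G S) (^-monoʳ-≤ 2 (+-monoʳ-≤ ∣ S ∣ (∣NSet∣≤∣S∣² G alliance))) ⟩
  #good G S * 2 ^ (∣ S ∣ + ∣ S ∣ * ∣ S ∣)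
    ≡⟨ cong (λ e → #good G S * 2 ^ e) (+-comm ∣ S ∣ (∣ S ∣ * ∣ S ∣)) ⟩
  #good G S * 2 ^ (∣ S ∣ * ∣ S ∣ + ∣ S ∣) ∎
  where
  open ≤-Reasoning
  R = NSet G S
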